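{- Let $d\geq 3$ and $n=2^d$. Let $A_1$ be a set of vertices of $FDSC_n$ and let $A_2$ be a set of pairs $\{y,z\}$ such that $(y,z)$ is an edge of $FDSC_n$, with $|A_1|+|A_2|\leq d$ and $|A_2|\leq d-1$. Then the graph $FDSC_n-(A_1\cup A_2)$, obtained by deleting all vertices in $A_1$ and all endpoints of the edges in $A_2$, is connected.
   Context: For $n=2^d$ ($d\ge 1$), the folded divide-and-swap cube $FDSC_n$ is the graph with vertex set $\{0,1\}^n$ (binary strings $u=s_1s_2\ldots s_n$). For $1\le k\le d$ write $u=m_1m_2m_3$ with $m_1=s_1\ldots s_{n/2^k}$, $m_2=s_{n/2^k+1}\ldots s_{n/2^{k-1}}$, $m_3=s_{n/2^{k-1}+1}\ldots s_n$ ($m_3$ empty when $k=1$). A vertex $v$ is adjacent to $u$ iff one of the following holds: (1) $v=\bar s_1s_2\ldots s_n$; (2) for some $1\le k\le d$, $v=\bar m_1\bar m_2m_3$ if $m_1=m_2$, and $v=m_2m_1m_3$ otherwise; (3) $v=s_1\bar s_2s_3\ldots s_n$. Here a bar denotes bitwise complement. -}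

module Defs where

open import Data.Nat using (ℕ; zero; suc; _+_; _*_; _^_; _<_)
open import Data.Bool using (Bool; true; false; not; if_then_else_)
open import Data.Bool.Properties using () renaming (_≟_ to _≟ᵇ_)
open import Data.List using (List; []; _∷_; _++_; take; drop; map)
open import Data.List.Properties using (≡-dec)
open import Data.List.Membership.Propositional using (_∉_)
open import Data.List.Relation.Unary.All using (All)
open import Data.Vec using (Vec; toList)
open import Data.Product using (_×_; proj₁; proj₂)
open import Relation.Nullary using (does)
open import Relation.Binary.PropositionalEquality using (_≡_; _≢_)

Vertex : ℕ → Set
Vertex d = Vec Bool (2 ^ d)

compl : List Bool → List Bool
compl = map not

flip1 : List Bool → List Bool
flip1 []       = []
flip1 (b ∷ bs) = not b ∷ bs

flip2 : List Bool → List Bool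
flip2 []           = []
flip2 (b ∷ [])     = b ∷ []
flip2 (b ∷ c ∷ bs) = b ∷ not c ∷ bs

-- operation (2) for level k, parameterised by j = d - k (0 ≤ j < d),
-- so that |m1| = |m2| = n/2^k = 2^j and m3 is the remaining suffix.
dsOp : ℕ → List Bool → List Bool
dsOp j u =
  let a  = 2 ^ j
      m1 = take a u
      m2 = take a (drop a u)
      m3 = drop (a + a) u
  in if does (≡-dec _≟ᵇ_ m1 m2)
       then compl m1 ++ compl m2 ++ m3
       else m2 ++ m1 ++ m3

data Adj (d : ℕ) (u v : Vertex d) : Set where
  adj1 : toList v ≡ flip1 (toList u) → Adj d u v
  adj2 : (j : ℕ) → j < d → toList v ≡ dsOp j (toList u) → Adj d u v
  adj3 : toList v ≡ flip2 (toList u) → Adj d u v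

Alive : (d : ℕ) → List (Vertex d) → List (Vertex d × Vertex d) → Vertex d → Set
Alive d A1 A2 u = (u ∉ A1) × All (λ e → (u ≢ proj₁ e) × (u ≢ proj₂ e)) A2

data Walk (d : ℕ) (P : Vertex d → Set) : Vertex d → Vertex d → Set where
  here : ∀ {u} → P u → Walk d P u u
  step : ∀ {u v w} → P u → Adj d u v → Walk d P v w → Walk d P u w

Connected : (d : ℕ) → (Vertex d → Set) → Set
Connected d P = ∀ (u v : Vertex d) → P u → P v → Walk d P u v

{-# OPTIONS --safe #-}

-- A vertex of dimension d + 1 is a pair of halves a h (join d a h). Operations (1), (3) and (2) for
-- k ≥ 2 only change the first half, acting on it as in dimension d, so the vertices with a common
-- second half h form a cluster isomorphic to the cube of dimension d; the remaining operation, topSwap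
-- (k = 1), is an involution that always changes the second half (adj-join-cases). Restricted to a
-- cluster, the faults never grow in number, so the induction hypothesis connects the survivors of each
-- cluster whose restricted faults still meet the bounds of the theorem ("good" clusters). There are
-- fewer than 2^(2^d) halves of faulty vertices, so some z is a half of no faulty vertex: every vertex
-- z h and h z survives and cluster z is fault-free, hence a survivor of a good cluster h walks to z h,
-- crosses to h z and reaches the hub z z inside cluster z. A bad cluster concentrates so many faults
-- that every other cluster is good, and its survivors escape along one or two topSwap edges; the
-- second case uses that with at most d faults every survivor has a surviving neighbour. The step needs
-- d ≥ 2; the base case d = 2 is settled by computation.

module Submission where

open import Defs
open import Data.Bool using (Bool; true; false; not; T; _∧_; _∨_; if_then_else_)
open import Data.Bool.ListAction using (all; any)
open import Data.Bool.Properties using (not-involutive; not-¬; ¬-not; T-∧; T-∨; T-≡; T-not-≡) renaming (_≟_ to _≟ᵇ_)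
open import Data.List as List using (List; []; _∷_; _++_; take; drop; length)
open import Data.List.Membership.Propositional using (_∈_; _∉_)
open import Data.List.Membership.Propositional.Properties
  using (∈-++⁻; ∈-++⁺ˡ; ∈-++⁺ʳ; ∈-map⁺; ∈-cartesianProductWith⁺)
import Data.List.Membership.DecPropositional as Membership
open import Data.List.Properties
  using (≡-dec; ∷-injectiveˡ; ∷-injectiveʳ; ++-assoc; ++-identityʳ; length-++; length-map; take++drop≡id;
         length-take; drop-drop)
open import Data.List.Relation.Unary.All as All using (All; []; _∷_)
open import Data.List.Relation.Unary.Any using (here; there)
open import Data.Maybe using (Maybe; just; nothing)
open import Data.Nat using (ℕ; zero; suc; _+_; _∸_; _^_; _≤_; _<_; s≤s; z≤n; _<?_; _≤?_)
open import Data.Nat.Properties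
  using (suc-injective; ≤-trans; ≤-refl; ≤-reflexive; ≤-pred; n≤1+n; m≤m+n; m≤n+m; m≤n⇒m≤1+n; n<1+n;
         m<n⇒m<1+n; m<1+n⇒m<n∨m≡n; m≤n⇒m<n∨m≡n; <⇒≱; ≮⇒≥; ≰⇒>; m≤n⇒m⊓n≡m; m+n≡0⇒n≡0;
         +-comm; +-assoc; +-suc; +-identityʳ; +-mono-≤; +-monoʳ-≤; +-mono-<; +-mono-<-≤; +-mono-≤-<;
         +-cancelˡ-≤; +-cancelʳ-≤; ^-monoʳ-≤; m^n>0; module ≤-Reasoning)
open import Data.Product using (∃; ∃₂; _×_; _,_; proj₁; proj₂; map; map₁; map₂)
open import Data.Sum using (_⊎_; inj₁; inj₂; [_,_]′)
open import Data.Vec as Vec using (Vec; []; toList)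
open import Data.Vec.Properties as Vec using (length-toList; toList-injective)
open import Data.Vec.Relation.Binary.Equality.Cast using (cast-is-id)
open import Function using (_∘_; Equivalence)
open import Relation.Binary.Definitions using (DecidableEquality)
open import Relation.Binary.PropositionalEquality
open import Relation.Nullary using (¬_; Dec; does; yes; no; contradiction)


++-cancel-≡length : ∀ {A : Set} (P Q : List A) {R S : List A} →
                    length P ≡ length Q → P ++ R ≡ Q ++ S → P ≡ Q × R ≡ S
++-cancel-≡length []      []      _   eq = refl , eq
++-cancel-≡length (x ∷ P) (y ∷ Q) |P| eq with ++-cancel-≡length P Q (suc-injective |P|) (∷-injectiveʳ eq)
... | refl , R≡S = cong (_∷ P) (∷-injectiveˡ eq) , R≡S

take-++ : ∀ {A : Set} {n} (P Q : List A) → length P ≡ n → take n (P ++ Q) ≡ P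
take-++ []      Q refl = refl
take-++ (x ∷ P) Q refl = cong (x ∷_) (take-++ P Q refl)

drop-++ : ∀ {A : Set} {n} (P Q : List A) → length P ≡ n → drop n (P ++ Q) ≡ Q
drop-++ []      Q refl = refl
drop-++ (x ∷ P) Q refl = drop-++ P Q refl

splitAt-≤ : ∀ {A : Set} n (X : List A) → n ≤ length X → ∃₂ λ P R → length P ≡ n × X ≡ P ++ R
splitAt-≤ n X n≤ = take n X , drop n X , trans (length-take n X) (m≤n⇒m⊓n≡m n≤) , sym (take++drop≡id n X)

∈-length≤1-unique : ∀ {A : Set} {xs : List A} {a b} → length xs ≤ 1 → a ∈ xs → b ∈ xs → a ≡ b
∈-length≤1-unique {xs = _ ∷ []}    _        (here refl) (here refl) = refl
∈-length≤1-unique {xs = _ ∷ _ ∷ _} (s≤s ())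

module _ {A B : Set} (f : A → Maybe B) where

  length-mapMaybe-≤ : ∀ xs → length (List.mapMaybe f xs) ≤ length xs
  length-mapMaybe-≤ []       = z≤n
  length-mapMaybe-≤ (x ∷ xs) with f x
  ... | just _  = s≤s (length-mapMaybe-≤ xs)
  ... | nothing = m≤n⇒m≤1+n (length-mapMaybe-≤ xs)

  length-mapMaybe-< : ∀ {x xs} → x ∈ xs → f x ≡ nothing → length (List.mapMaybe f xs) < length xs
  length-mapMaybe-< {xs = x ∷ xs} (here refl) fx≡ rewrite fx≡ = s≤s (length-mapMaybe-≤ xs)
  length-mapMaybe-< {xs = y ∷ xs} (there x∈) fx≡ with f y
  ... | just _  = s≤s (length-mapMaybe-< x∈ fx≡)
  ... | nothing = m≤n⇒m≤1+n (length-mapMaybe-< x∈ fx≡)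

  mapMaybe-≡[] : ∀ xs → (∀ {x} → x ∈ xs → f x ≡ nothing) → List.mapMaybe f xs ≡ []
  mapMaybe-≡[] []       _   = refl
  mapMaybe-≡[] (x ∷ xs) nothings rewrite nothings (here refl) = mapMaybe-≡[] xs (nothings ∘ there)

  ∈-mapMaybe⁺ : ∀ {x y xs} → x ∈ xs → f x ≡ just y → y ∈ List.mapMaybe f xs
  ∈-mapMaybe⁺ {xs = x ∷ xs} (here refl) fx≡ rewrite fx≡ = here refl
  ∈-mapMaybe⁺ {xs = z ∷ xs} (there x∈) fx≡ with f z
  ... | just _  = there (∈-mapMaybe⁺ x∈ fx≡)
  ... | nothing = ∈-mapMaybe⁺ x∈ fx≡

  ∈-mapMaybe⁻ : ∀ {y} xs → y ∈ List.mapMaybe f xs → ∃ λ x → x ∈ xs × f x ≡ just y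
  ∈-mapMaybe⁻ (x ∷ xs) y∈ with f x in fx≡
  ∈-mapMaybe⁻ (x ∷ xs) (here refl) | just _  = x , here refl , fx≡
  ∈-mapMaybe⁻ (x ∷ xs) (there y∈)  | just _  = map₂ (map₁ there) (∈-mapMaybe⁻ xs y∈)
  ∈-mapMaybe⁻ (x ∷ xs) y∈          | nothing = map₂ (map₁ there) (∈-mapMaybe⁻ xs y∈)

module _ {A B C : Set} (f : A → Maybe B) (g : A → Maybe C) (disjoint : ∀ x → f x ≡ nothing ⊎ g x ≡ nothing) where

  length-mapMaybe₂-≤ : ∀ xs → length (List.mapMaybe f xs) + length (List.mapMaybe g xs) ≤ length xs
  length-mapMaybe₂-≤ [] = z≤n
  length-mapMaybe₂-≤ (x ∷ xs) with f x | g x | disjoint x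
  ... | nothing | nothing | _       = m≤n⇒m≤1+n (length-mapMaybe₂-≤ xs)
  ... | just _  | nothing | _       = s≤s (length-mapMaybe₂-≤ xs)
  ... | nothing | just _  | _       = subst (_≤ suc (length xs)) (sym (+-suc _ _)) (s≤s (length-mapMaybe₂-≤ xs))
  ... | just _  | just _  | inj₁ ()
  ... | just _  | just _  | inj₂ ()

  length-mapMaybe₂-< : ∀ {x xs} → x ∈ xs → f x ≡ nothing → g x ≡ nothing →
                       length (List.mapMaybe f xs) + length (List.mapMaybe g xs) < length xs
  length-mapMaybe₂-< {xs = x ∷ xs} (here refl) fx≡ gx≡ rewrite fx≡ | gx≡ = s≤s (length-mapMaybe₂-≤ xs)
  length-mapMaybe₂-< {xs = y ∷ xs} (there x∈) fx≡ gx≡ with f y | g y | disjoint y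
  ... | nothing | nothing | _       = m≤n⇒m≤1+n (length-mapMaybe₂-< x∈ fx≡ gx≡)
  ... | just _  | nothing | _       = s≤s (length-mapMaybe₂-< x∈ fx≡ gx≡)
  ... | nothing | just _  | _       = subst (_< suc (length xs)) (sym (+-suc _ _)) (s≤s (length-mapMaybe₂-< x∈ fx≡ gx≡))
  ... | just _  | just _  | inj₁ ()
  ... | just _  | just _  | inj₂ ()

private
  headed : ∀ {n} → Bool → Vec Bool (suc n) → Maybe (Vec Bool n)
  headed b (c Vec.∷ v) with b ≟ᵇ c
  ... | yes _ = just v
  ... | no _  = nothing

  headed-disjoint : ∀ {n} (v : Vec Bool (suc n)) → headed true v ≡ nothing ⊎ headed false v ≡ nothing
  headed-disjoint (true Vec.∷ v)  = inj₂ refl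
  headed-disjoint (false Vec.∷ v) = inj₁ refl

  ∉-headed : ∀ {n} b {v : Vec Bool n} {B} → v ∉ List.mapMaybe (headed b) B → (b Vec.∷ v) ∉ B
  ∉-headed b {v} v∉ bv∈ = v∉ (∈-mapMaybe⁺ (headed b) bv∈ headed-b)
    where
    headed-b : headed b (b Vec.∷ v) ≡ just v
    headed-b with b ≟ᵇ b
    ... | yes _   = refl
    ... | no b≢b = contradiction refl b≢b

∃-∉ : ∀ n (B : List (Vec Bool n)) → length B < 2 ^ n → ∃ λ v → v ∉ B
∃-∉ zero    []      _        = [] , λ ()
∃-∉ zero    (_ ∷ _) (s≤s ())
∃-∉ (suc n) B       |B|< with length (List.mapMaybe (headed true) B) <? 2 ^ n
                              | length (List.mapMaybe (headed false) B) <? 2 ^ n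
... | yes T< | _      = map (true Vec.∷_) (∉-headed true) (∃-∉ n _ T<)
... | no _   | yes F< = map (false Vec.∷_) (∉-headed false) (∃-∉ n _ F<)
... | no T≮  | no F≮  = contradiction (≤-trans (+-mono-≤ (≮⇒≥ T≮) (≮⇒≥ F≮))
                                               (length-mapMaybe₂-≤ (headed true) (headed false) headed-disjoint B))
                                      (<⇒≱ (subst (length B <_) (cong (2 ^ n +_) (+-identityʳ (2 ^ n))) |B|<))

compl-involutive : ∀ P → compl (compl P) ≡ P
compl-involutive []      = refl
compl-involutive (b ∷ P) = cong₂ _∷_ (not-involutive b) (compl-involutive P)

compl-≢ : ∀ P → 1 ≤ length P → compl P ≢ P
compl-≢ (true ∷ P)  _ ()
compl-≢ (false ∷ P) _ ()

flip1-involutive : ∀ P → flip1 (flip1 P) ≡ P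
flip1-involutive []      = refl
flip1-involutive (b ∷ P) = cong (_∷ P) (not-involutive b)

flip2-involutive : ∀ P → flip2 (flip2 P) ≡ P
flip2-involutive []          = refl
flip2-involutive (b ∷ [])    = refl
flip2-involutive (b ∷ c ∷ P) = cong (λ c′ → b ∷ c′ ∷ P) (not-involutive c)

flip1-≢ : ∀ P → 1 ≤ length P → flip1 P ≢ P
flip1-≢ (true ∷ P)  _ ()
flip1-≢ (false ∷ P) _ ()

flip2-≢ : ∀ P → 2 ≤ length P → flip2 P ≢ P
flip2-≢ (b ∷ [])        (s≤s ())
flip2-≢ (b ∷ true ∷ P)  _ ()
flip2-≢ (b ∷ false ∷ P) _ ()

flip1-++ : ∀ P S → 1 ≤ length P → flip1 (P ++ S) ≡ flip1 P ++ S
flip1-++ (b ∷ P) S _ = refl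

flip2-++ : ∀ P S → 2 ≤ length P → flip2 (P ++ S) ≡ flip2 P ++ S
flip2-++ (b ∷ [])    S (s≤s ())
flip2-++ (b ∷ c ∷ P) S _ = refl

length-flip1 : ∀ P → length (flip1 P) ≡ length P
length-flip1 []      = refl
length-flip1 (b ∷ P) = refl

length-flip2 : ∀ P → length (flip2 P) ≡ length P
length-flip2 []          = refl
length-flip2 (b ∷ [])    = refl
length-flip2 (b ∷ c ∷ P) = refl

module _ (j : ℕ) (P Q R : List Bool) (|P| : length P ≡ 2 ^ j) (|Q| : length Q ≡ 2 ^ j) where

  private
    dsOp-blocks : dsOp j (P ++ Q ++ R) ≡ (if does (≡-dec _≟ᵇ_ P Q) then compl P ++ compl Q ++ R else Q ++ P ++ R)
    dsOp-blocks
      rewrite take-++ P (Q ++ R) |P| | drop-++ P (Q ++ R) |P| | take-++ Q R |Q|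
            | sym (drop-drop (2 ^ j) (2 ^ j) (P ++ Q ++ R)) | drop-++ P (Q ++ R) |P| | drop-++ Q R |Q|
      = refl

  dsOp-equal : P ≡ Q → dsOp j (P ++ Q ++ R) ≡ compl P ++ compl Q ++ R
  dsOp-equal P≡Q rewrite dsOp-blocks with ≡-dec _≟ᵇ_ P Q
  ... | yes _   = refl
  ... | no P≢Q = contradiction P≡Q P≢Q

  dsOp-distinct : P ≢ Q → dsOp j (P ++ Q ++ R) ≡ Q ++ P ++ R
  dsOp-distinct P≢Q rewrite dsOp-blocks with ≡-dec _≟ᵇ_ P Q
  ... | yes P≡Q = contradiction P≡Q P≢Q
  ... | no _    = refl

data Blocks (j : ℕ) : List Bool → Set where
  blocks : ∀ P Q R → length P ≡ 2 ^ j → length Q ≡ 2 ^ j → Blocks j (P ++ Q ++ R)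

toBlocks : ∀ j X → 2 ^ j + 2 ^ j ≤ length X → Blocks j X
toBlocks j X n+n≤ with splitAt-≤ (2 ^ j) X (≤-trans (m≤m+n (2 ^ j) (2 ^ j)) n+n≤)
... | P , R₁ , |P| , refl with splitAt-≤ (2 ^ j) R₁ n≤|R₁|
  where
  n≤|R₁| : 2 ^ j ≤ length R₁
  n≤|R₁| = +-cancelˡ-≤ (2 ^ j) _ _ (≤-trans n+n≤ (≤-reflexive (trans (length-++ P) (cong (_+ length R₁) |P|))))
... | Q , R , |Q| , refl = blocks P Q R |P| |Q|

module _ (j : ℕ) where

  private
    length-blocks : ∀ (P P′ Q Q′ R : List Bool) → length P ≡ length P′ → length Q ≡ length Q′ →
                    length (P ++ Q ++ R) ≡ length (P′ ++ Q′ ++ R)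
    length-blocks P P′ Q Q′ R |P| |Q|
      rewrite length-++ P {Q ++ R} | length-++ P′ {Q′ ++ R} | length-++ Q {R} | length-++ Q′ {R} | |P| | |Q| = refl

    ++-assoc₃ : ∀ (P Q R S : List Bool) → (P ++ Q ++ R) ++ S ≡ P ++ Q ++ R ++ S
    ++-assoc₃ P Q R S = trans (++-assoc P (Q ++ R) S) (cong (P ++_) (++-assoc Q R S))

  dsOp-involutive : ∀ X → 2 ^ j + 2 ^ j ≤ length X → dsOp j (dsOp j X) ≡ X
  dsOp-involutive X n+n≤ with toBlocks j X n+n≤
  ... | blocks P Q R |P| |Q| with ≡-dec _≟ᵇ_ P Q
  ... | yes refl = begin
    dsOp j (dsOp j (P ++ P ++ R))               ≡⟨ cong (dsOp j) (dsOp-equal j P P R |P| |P| refl) ⟩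
    dsOp j (compl P ++ compl P ++ R)            ≡⟨ dsOp-equal j (compl P) (compl P) R |P̄| |P̄| refl ⟩
    compl (compl P) ++ compl (compl P) ++ R     ≡⟨ cong (λ P′ → P′ ++ P′ ++ R) (compl-involutive P) ⟩
    P ++ P ++ R                                 ∎
    where
    open ≡-Reasoning
    |P̄| = trans (length-map not P) |P|
  ... | no P≢Q = trans (cong (dsOp j) (dsOp-distinct j P Q R |P| |Q| P≢Q)) (dsOp-distinct j Q P R |Q| |P| (P≢Q ∘ sym))

  dsOp-≢ : ∀ X → 2 ^ j + 2 ^ j ≤ length X → dsOp j X ≢ X
  dsOp-≢ X n+n≤ with toBlocks j X n+n≤
  ... | blocks P Q R |P| |Q| with ≡-dec _≟ᵇ_ P Q
  ... | yes refl = λ eq → compl-≢ P (subst (1 ≤_) (sym |P|) (m^n>0 2 j))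
                     (proj₁ (++-cancel-≡length (compl P) P (length-map not P) (trans (sym (dsOp-equal j P P R |P| |P| refl)) eq)))
  ... | no P≢Q = λ eq → P≢Q (sym (proj₁ (++-cancel-≡length Q P (trans |Q| (sym |P|)) (trans (sym (dsOp-distinct j P Q R |P| |Q| P≢Q)) eq))))

  dsOp-++ : ∀ X S → 2 ^ j + 2 ^ j ≤ length X → dsOp j (X ++ S) ≡ dsOp j X ++ S
  dsOp-++ X S n+n≤ with toBlocks j X n+n≤
  ... | blocks P Q R |P| |Q| rewrite ++-assoc₃ P Q R S with ≡-dec _≟ᵇ_ P Q
  ... | yes P≡Q rewrite dsOp-equal j P Q (R ++ S) |P| |Q| P≡Q | dsOp-equal j P Q R |P| |Q| P≡Q = sym (++-assoc₃ (compl P) (compl Q) R S)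
  ... | no P≢Q rewrite dsOp-distinct j P Q (R ++ S) |P| |Q| P≢Q | dsOp-distinct j P Q R |P| |Q| P≢Q = sym (++-assoc₃ Q P R S)

  length-dsOp : ∀ X → 2 ^ j + 2 ^ j ≤ length X → length (dsOp j X) ≡ length X
  length-dsOp X n+n≤ with toBlocks j X n+n≤
  ... | blocks P Q R |P| |Q| with ≡-dec _≟ᵇ_ P Q
  ... | yes P≡Q rewrite dsOp-equal j P Q R |P| |Q| P≡Q = length-blocks (compl P) P (compl Q) Q R (length-map not P) (length-map not Q)
  ... | no P≢Q rewrite dsOp-distinct j P Q R |P| |Q| P≢Q = length-blocks Q P P Q R (trans |Q| (sym |P|)) (trans |P| (sym |Q|))

blocks-fit : ∀ {j d} → j < d → 2 ^ j + 2 ^ j ≤ 2 ^ d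
blocks-fit {j} {d} j<d = subst (_≤ 2 ^ d) (cong (2 ^ j +_) (+-identityʳ (2 ^ j))) (^-monoʳ-≤ 2 j<d)

length-toList-≥ : ∀ {A : Set} {m n} (u : Vec A n) → m ≤ n → m ≤ length (toList u)
length-toList-≥ u = subst (_ ≤_) (sym (length-toList u))

private
  inverse-of-involution : ∀ {A : Set} (f : A → A) {x y} → f (f x) ≡ x → y ≡ f x → x ≡ f y
  inverse-of-involution f ffx≡x y≡fx = trans (sym ffx≡x) (cong f (sym y≡fx))

adj-sym : ∀ {d} {u v : Vertex d} → Adj d u v → Adj d v u
adj-sym (adj1 p)           = adj1 (inverse-of-involution flip1 (flip1-involutive _) p)
adj-sym {u = u} (adj2 j j<d p) =
  adj2 j j<d (inverse-of-involution (dsOp j) (dsOp-involutive j _ (length-toList-≥ u (blocks-fit j<d))) p)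
adj-sym (adj3 p)           = adj3 (inverse-of-involution flip2 (flip2-involutive _) p)

adj-irrefl : ∀ {d} {u : Vertex (suc d)} → ¬ Adj (suc d) u u
adj-irrefl {d} {u} (adj1 p)       = flip1-≢ _ (length-toList-≥ u (m^n>0 2 (suc d))) (sym p)
adj-irrefl {d} {u} (adj2 j j<d p) = dsOp-≢ j _ (length-toList-≥ u (blocks-fit j<d)) (sym p)
adj-irrefl {d} {u} (adj3 p)       = flip2-≢ _ (length-toList-≥ u (^-monoʳ-≤ 2 {1} {suc d} (s≤s z≤n))) (sym p)

adj-complete₁ : ∀ (u v : Vertex 1) → u ≢ v → Adj 1 u v
adj-complete₁ (true Vec.∷ true Vec.∷ Vec.[]) (true Vec.∷ true Vec.∷ Vec.[]) u≢v = contradiction refl u≢v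
adj-complete₁ (true Vec.∷ true Vec.∷ Vec.[]) (true Vec.∷ false Vec.∷ Vec.[]) u≢v = adj3 refl
adj-complete₁ (true Vec.∷ true Vec.∷ Vec.[]) (false Vec.∷ true Vec.∷ Vec.[]) u≢v = adj1 refl
adj-complete₁ (true Vec.∷ true Vec.∷ Vec.[]) (false Vec.∷ false Vec.∷ Vec.[]) u≢v = adj2 0 (s≤s z≤n) refl
adj-complete₁ (true Vec.∷ false Vec.∷ Vec.[]) (true Vec.∷ true Vec.∷ Vec.[]) u≢v = adj3 refl
adj-complete₁ (true Vec.∷ false Vec.∷ Vec.[]) (true Vec.∷ false Vec.∷ Vec.[]) u≢v = contradiction refl u≢v
adj-complete₁ (true Vec.∷ false Vec.∷ Vec.[]) (false Vec.∷ true Vec.∷ Vec.[]) u≢v = adj2 0 (s≤s z≤n) refl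
adj-complete₁ (true Vec.∷ false Vec.∷ Vec.[]) (false Vec.∷ false Vec.∷ Vec.[]) u≢v = adj1 refl
adj-complete₁ (false Vec.∷ true Vec.∷ Vec.[]) (true Vec.∷ true Vec.∷ Vec.[]) u≢v = adj1 refl
adj-complete₁ (false Vec.∷ true Vec.∷ Vec.[]) (true Vec.∷ false Vec.∷ Vec.[]) u≢v = adj2 0 (s≤s z≤n) refl
adj-complete₁ (false Vec.∷ true Vec.∷ Vec.[]) (false Vec.∷ true Vec.∷ Vec.[]) u≢v = contradiction refl u≢v
adj-complete₁ (false Vec.∷ true Vec.∷ Vec.[]) (false Vec.∷ false Vec.∷ Vec.[]) u≢v = adj3 refl
adj-complete₁ (false Vec.∷ false Vec.∷ Vec.[]) (true Vec.∷ true Vec.∷ Vec.[]) u≢v = adj2 0 (s≤s z≤n) refl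
adj-complete₁ (false Vec.∷ false Vec.∷ Vec.[]) (true Vec.∷ false Vec.∷ Vec.[]) u≢v = adj1 refl
adj-complete₁ (false Vec.∷ false Vec.∷ Vec.[]) (false Vec.∷ true Vec.∷ Vec.[]) u≢v = adj3 refl
adj-complete₁ (false Vec.∷ false Vec.∷ Vec.[]) (false Vec.∷ false Vec.∷ Vec.[]) u≢v = contradiction refl u≢v

-- Halves, clusters and the top-level swap

toList-inj : ∀ {A : Set} {n} (u v : Vec A n) → toList u ≡ toList v → u ≡ v
toList-inj u v eq = trans (sym (cast-is-id refl u)) (toList-injective refl u v eq)

_≟ᵛ_ : ∀ {n} → DecidableEquality (Vec Bool n)
_≟ᵛ_ = Vec.≡-dec _≟ᵇ_

-- The trailing [] matches the normal form 2 ^ d + (2 ^ d + 0) of 2 ^ suc d.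
join : ∀ d → Vertex d → Vertex d → Vertex (suc d)
join d a h = a Vec.++ h Vec.++ []

lo : ∀ d → Vertex (suc d) → Vertex d
lo d = Vec.take (2 ^ d)

hi : ∀ d → Vertex (suc d) → Vertex d
hi d u = Vec.take (2 ^ d) (Vec.drop (2 ^ d) u)

join-lo-hi : ∀ d (u : Vertex (suc d)) → join d (lo d u) (hi d u) ≡ u
join-lo-hi d u = trans (cong (lo d u Vec.++_) (trans (cong (hi d u Vec.++_) (empty _)) (Vec.take++drop≡id (2 ^ d) r)))
                       (Vec.take++drop≡id (2 ^ d) u)
  where
  r = Vec.drop (2 ^ d) u
  empty : ∀ {A : Set} (v : Vec A 0) → [] ≡ v
  empty [] = refl

join-injective : ∀ d (a b h k : Vertex d) → join d a h ≡ join d b k → a ≡ b × h ≡ k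
join-injective d a b h k eq =
  Vec.++-injectiveˡ a b eq , Vec.++-injectiveˡ h k (Vec.++-injectiveʳ a b eq)

lo-join : ∀ d (a h : Vertex d) → lo d (join d a h) ≡ a
lo-join d a h = proj₁ (join-injective d _ a (hi d (join d a h)) h (join-lo-hi d (join d a h)))

hi-join : ∀ d (a h : Vertex d) → hi d (join d a h) ≡ h
hi-join d a h = proj₂ (join-injective d (lo d (join d a h)) a _ h (join-lo-hi d (join d a h)))

toList-join : ∀ d (a h : Vertex d) → toList (join d a h) ≡ toList a ++ toList h ++ []
toList-join d a h = trans (Vec.toList-++ a (h Vec.++ [])) (cong (toList a ++_) (Vec.toList-++ h []))

swapHalves : ∀ d → Vertex d → Vertex d → Vertex (suc d)
swapHalves d a h with a ≟ᵛ h
... | yes _ = join d (Vec.map not a) (Vec.map not h)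
... | no _  = join d h a

topSwap : ∀ d → Vertex (suc d) → Vertex (suc d)
topSwap d u = swapHalves d (lo d u) (hi d u)

topSwap-join : ∀ d (a h : Vertex d) → topSwap d (join d a h) ≡ swapHalves d a h
topSwap-join d a h = cong₂ (swapHalves d) (lo-join d a h) (hi-join d a h)

swapHalves-≢ : ∀ d {a h : Vertex d} → a ≢ h → swapHalves d a h ≡ join d h a
swapHalves-≢ d {a} {h} a≢h with a ≟ᵛ h
... | yes a≡h = contradiction a≡h a≢h
... | no _    = refl

hi-swapHalves : ∀ d (a h : Vertex d) → hi d (swapHalves d a h) ≢ h
hi-swapHalves d a h with a ≟ᵛ h
... | yes refl = λ eq → compl-≢ (toList a) (length-toList-≥ a (m^n>0 2 d))
                          (trans (sym (Vec.toList-map not a)) (cong toList (trans (sym (hi-join d (Vec.map not a) (Vec.map not a))) eq)))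
... | no a≢h   = λ eq → a≢h (trans (sym (hi-join d h a)) eq)

toList-swapHalves : ∀ d (a h : Vertex d) → toList (swapHalves d a h) ≡ dsOp d (toList (join d a h))
toList-swapHalves d a h rewrite toList-join d a h with a ≟ᵛ h
... | yes refl = begin
  toList (join d (Vec.map not a) (Vec.map not a))       ≡⟨ toList-join d (Vec.map not a) (Vec.map not a) ⟩
  toList (Vec.map not a) ++ toList (Vec.map not a) ++ [] ≡⟨ cong (λ P → P ++ P ++ []) (Vec.toList-map not a) ⟩
  compl (toList a) ++ compl (toList a) ++ []            ≡⟨ dsOp-equal d (toList a) (toList a) [] (length-toList a) (length-toList a) refl ⟨
  dsOp d (toList a ++ toList a ++ [])                   ∎
  where open ≡-Reasoning
... | no a≢h = trans (toList-join d h a)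
                     (sym (dsOp-distinct d (toList a) (toList h) [] (length-toList a) (length-toList h) (a≢h ∘ toList-inj a h)))

toList-topSwap : ∀ d (u : Vertex (suc d)) → toList (topSwap d u) ≡ dsOp d (toList u)
toList-topSwap d u = trans (toList-swapHalves d (lo d u) (hi d u)) (cong (dsOp d ∘ toList) (join-lo-hi d u))

adj-topSwap : ∀ d (u : Vertex (suc d)) → Adj (suc d) u (topSwap d u)
adj-topSwap d u = adj2 d (n<1+n d) (toList-topSwap d u)

topSwap-involutive : ∀ d (u : Vertex (suc d)) → topSwap d (topSwap d u) ≡ u
topSwap-involutive d u = toList-inj _ u (begin
  toList (topSwap d (topSwap d u)) ≡⟨ toList-topSwap d _ ⟩
  dsOp d (toList (topSwap d u))    ≡⟨ cong (dsOp d) (toList-topSwap d u) ⟩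
  dsOp d (dsOp d (toList u))       ≡⟨ dsOp-involutive d _ (length-toList-≥ u (≤-reflexive (cong (2 ^ d +_) (sym (+-identityʳ _))))) ⟩
  toList u                         ∎)
  where open ≡-Reasoning

topSwap-injective : ∀ d {u v : Vertex (suc d)} → topSwap d u ≡ topSwap d v → u ≡ v
topSwap-injective d {u} {v} eq = trans (sym (topSwap-involutive d u)) (trans (cong (topSwap d) eq) (topSwap-involutive d v))

hi-topSwap : ∀ d (u : Vertex (suc d)) → hi d (topSwap d u) ≢ hi d u
hi-topSwap d u = hi-swapHalves d (lo d u) (hi d u)

module _ (d : ℕ) {a : Vertex d} (h : Vertex d) (f : List Bool → List Bool)
         (f-++ : ∀ S → f (toList a ++ S) ≡ f (toList a) ++ S) where

  toList-join-step : ∀ {a′} → toList a′ ≡ f (toList a) → toList (join d a′ h) ≡ f (toList (join d a h))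
  toList-join-step {a′} p = begin
    toList (join d a′ h)          ≡⟨ toList-join d a′ h ⟩
    toList a′ ++ toList h ++ []   ≡⟨ cong (_++ toList h ++ []) p ⟩
    f (toList a) ++ toList h ++ [] ≡⟨ f-++ (toList h ++ []) ⟨
    f (toList a ++ toList h ++ []) ≡⟨ cong f (toList-join d a h) ⟨
    f (toList (join d a h))       ∎
    where open ≡-Reasoning

  toList-join-step⁻ : length (f (toList a)) ≡ 2 ^ d → ∀ v → toList v ≡ f (toList (join d a h)) →
                      toList (lo d v) ≡ f (toList a) × hi d v ≡ h
  toList-join-step⁻ |fa| v p = lo≡ , toList-inj (hi d v) h (trans (sym (++-identityʳ _)) (trans hi≡ (++-identityʳ _)))
    where
    halves : toList (lo d v) ++ toList (hi d v) ++ [] ≡ f (toList a) ++ toList h ++ []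
    halves = begin
      toList (lo d v) ++ toList (hi d v) ++ [] ≡⟨ toList-join d (lo d v) (hi d v) ⟨
      toList (join d (lo d v) (hi d v))        ≡⟨ cong toList (join-lo-hi d v) ⟩
      toList v                                 ≡⟨ p ⟩
      f (toList (join d a h))                  ≡⟨ cong f (toList-join d a h) ⟩
      f (toList a ++ toList h ++ [])           ≡⟨ f-++ (toList h ++ []) ⟩
      f (toList a) ++ toList h ++ []           ∎
      where open ≡-Reasoning
    split = ++-cancel-≡length (toList (lo d v)) (f (toList a)) (trans (length-toList (lo d v)) (sym |fa|)) halves
    lo≡ = proj₁ split
    hi≡ = proj₂ split

adj-inner : ∀ e {a a′ : Vertex (suc e)} h → Adj (suc e) a a′ → Adj (suc (suc e)) (join (suc e) a h) (join (suc e) a′ h)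
adj-inner e {a} h (adj1 p) =
  adj1 (toList-join-step (suc e) h flip1 (λ S → flip1-++ (toList a) S (length-toList-≥ a (m^n>0 2 (suc e)))) p)
adj-inner e {a} h (adj2 j j<d p) =
  adj2 j (m<n⇒m<1+n j<d) (toList-join-step (suc e) h (dsOp j) (λ S → dsOp-++ j (toList a) S (length-toList-≥ a (blocks-fit j<d))) p)
adj-inner e {a} h (adj3 p) =
  adj3 (toList-join-step (suc e) h flip2 (λ S → flip2-++ (toList a) S (length-toList-≥ a (^-monoʳ-≤ 2 {1} {suc e} (s≤s z≤n)))) p)

stays-in-cluster : ∀ d {h : Vertex d} v → hi d v ≡ h → v ≡ join d (lo d v) h
stays-in-cluster d v hi≡ = trans (sym (join-lo-hi d v)) (cong (join d (lo d v)) hi≡)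

adj-join-cases : ∀ e (a h : Vertex (suc e)) {v} → Adj (suc (suc e)) (join (suc e) a h) v →
                 (∃ λ a′ → v ≡ join (suc e) a′ h × Adj (suc e) a a′) ⊎ v ≡ swapHalves (suc e) a h
adj-join-cases e a h {v} (adj1 p)
  with toList-join-step⁻ (suc e) h flip1 (λ S → flip1-++ (toList a) S (length-toList-≥ a (m^n>0 2 (suc e))))
                         (trans (length-flip1 (toList a)) (length-toList a)) v p
... | lo≡ , hi≡ = inj₁ (lo (suc e) v , stays-in-cluster (suc e) v hi≡ , adj1 lo≡)
adj-join-cases e a h {v} (adj3 p)
  with toList-join-step⁻ (suc e) h flip2 (λ S → flip2-++ (toList a) S (length-toList-≥ a (^-monoʳ-≤ 2 {1} {suc e} (s≤s z≤n))))
                         (trans (length-flip2 (toList a)) (length-toList a)) v p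
... | lo≡ , hi≡ = inj₁ (lo (suc e) v , stays-in-cluster (suc e) v hi≡ , adj3 lo≡)
adj-join-cases e a h {v} (adj2 j j<2+e p) with m<1+n⇒m<n∨m≡n j<2+e
... | inj₂ refl = inj₂ (toList-inj v _ (trans p (sym (toList-swapHalves (suc e) a h))))
... | inj₁ j<d
  with toList-join-step⁻ (suc e) h (dsOp j) (λ S → dsOp-++ j (toList a) S (length-toList-≥ a (blocks-fit j<d)))
                         (trans (length-dsOp j (toList a) (length-toList-≥ a (blocks-fit j<d))) (length-toList a)) v p
...   | lo≡ , hi≡ = inj₁ (lo (suc e) v , stays-in-cluster (suc e) v hi≡ , adj2 j j<d lo≡)

adj-across : ∀ e {u v : Vertex (suc (suc e))} → Adj (suc (suc e)) u v → hi (suc e) v ≢ hi (suc e) u →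
             v ≡ topSwap (suc e) u
adj-across e {u} {v} u~v hi≢ with adj-join-cases e (lo (suc e) u) (hi (suc e) u) (subst (λ w → Adj (suc (suc e)) w v) (sym (join-lo-hi (suc e) u)) u~v)
... | inj₁ (a′ , v≡ , _) = contradiction (trans (cong (hi (suc e)) v≡) (hi-join (suc e) a′ (hi (suc e) u))) hi≢
... | inj₂ v≡              = v≡

adj-within : ∀ e {a b h : Vertex (suc e)} → Adj (suc (suc e)) (join (suc e) a h) (join (suc e) b h) → Adj (suc e) a b
adj-within e {a} {b} {h} a~b with adj-join-cases e a h a~b
... | inj₁ (a′ , eq , a~a′) = subst (Adj (suc e) a) (sym (proj₁ (join-injective (suc e) b a′ h h eq))) a~a′
... | inj₂ eq = contradiction (trans (sym (cong (hi (suc e)) eq)) (hi-join (suc e) b h)) (hi-swapHalves (suc e) a h)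

module _ {d : ℕ} {P : Vertex d → Set} where

  _▻_ : ∀ {u v w} → Walk d P u v → Walk d P v w → Walk d P u w
  here _       ▻ q = q
  step pu u~ p ▻ q = step pu u~ (p ▻ q)

  walk-target : ∀ {u v} → Walk d P u v → P v
  walk-target (here pu)    = pu
  walk-target (step _ _ p) = walk-target p

  walk-snoc : ∀ {u v w} → Walk d P u v → Adj d v w → P w → Walk d P u w
  walk-snoc p v~w pw = p ▻ step (walk-target p) v~w (here pw)

  walk-reverse : ∀ {u v} → Walk d P u v → Walk d P v u
  walk-reverse (here pu)       = here pu
  walk-reverse (step pu u~v p) = walk-snoc (walk-reverse p) (adj-sym u~v) pu

  connected-via : ∀ w → (∀ u → P u → Walk d P u w) → Connected d P
  connected-via w to-w u v pu pv = to-w u pu ▻ walk-reverse (to-w v pv)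

walk-map : ∀ {d} {P Q : Vertex d → Set} → (∀ {u} → P u → Q u) → ∀ {u v} → Walk d P u v → Walk d Q u v
walk-map P⇒Q (here pu)       = here (P⇒Q pu)
walk-map P⇒Q (step pu u~v p) = step (P⇒Q pu) u~v (walk-map P⇒Q p)

walk-join : ∀ e (h : Vertex (suc e)) {P : Vertex (suc e) → Set} {Q : Vertex (suc (suc e)) → Set} →
            (∀ {a} → P a → Q (join (suc e) a h)) →
            ∀ {a b} → Walk (suc e) P a b → Walk (suc (suc e)) Q (join (suc e) a h) (join (suc e) b h)
walk-join e h P⇒Q (here pa)       = here (P⇒Q pa)
walk-join e h P⇒Q (step pa a~b p) = step (P⇒Q pa) (adj-inner e h a~b) (walk-join e h P⇒Q p)

Edge : ℕ → Set
Edge d = Vertex d × Vertex d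

AllAdjacent : ∀ d → List (Edge d) → Set
AllAdjacent d A2 = All (λ e → Adj d (proj₁ e) (proj₂ e)) A2

ends : ∀ d → List (Edge d) → List (Vertex d)
ends d []             = []
ends d ((y , z) ∷ es) = y ∷ z ∷ ends d es

length-ends : ∀ d (es : List (Edge d)) → length (ends d es) ≡ length es + length es
length-ends d []             = refl
length-ends d ((y , z) ∷ es) = cong suc (trans (cong suc (length-ends d es)) (sym (+-suc (length es) (length es))))

length-faulty : ∀ d (A1 : List (Vertex d)) (A2 : List (Edge d)) →
                length (A1 ++ ends d A2) ≡ length A1 + length A2 + length A2
length-faulty d A1 A2 = trans (length-++ A1) (trans (cong (length A1 +_) (length-ends d A2)) (sym (+-assoc (length A1) _ _)))

∈-ends⁻ : ∀ d {u} (es : List (Edge d)) → u ∈ ends d es → ∃ λ e → e ∈ es × (u ≡ proj₁ e ⊎ u ≡ proj₂ e)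
∈-ends⁻ d (e ∷ es) (here u≡)         = e , here refl , inj₁ u≡
∈-ends⁻ d (e ∷ es) (there (here u≡)) = e , here refl , inj₂ u≡
∈-ends⁻ d (e ∷ es) (there (there u∈)) = map₂ (map₁ there) (∈-ends⁻ d es u∈)

∈-ends⁺ : ∀ d {y z} {es : List (Edge d)} → (y , z) ∈ es → y ∈ ends d es × z ∈ ends d es
∈-ends⁺ d (here refl) = here refl , there (here refl)
∈-ends⁺ d {es = _ ∷ _} (there e∈) = map₁ (there ∘ there) (map₂ (there ∘ there) (∈-ends⁺ d e∈))

module _ {d : ℕ} {A1 : List (Vertex d)} {A2 : List (Edge d)} {u : Vertex d} where

  alive⇒∉ : Alive d A1 A2 u → u ∉ A1 ++ ends d A2
  alive⇒∉ (u∉A1 , u-avoids) u∈ with ∈-++⁻ A1 u∈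
  ... | inj₁ u∈A1 = u∉A1 u∈A1
  ... | inj₂ u∈ends = avoids⇒∉ u-avoids u∈ends
    where
    avoids⇒∉ : ∀ {es} → All (λ e → (u ≢ proj₁ e) × (u ≢ proj₂ e)) es → u ∉ ends d es
    avoids⇒∉ ((u≢y , _) ∷ _)   (here u≡y)         = u≢y u≡y
    avoids⇒∉ ((_ , u≢z) ∷ _)   (there (here u≡z)) = u≢z u≡z
    avoids⇒∉ (_ ∷ avoids)      (there (there u∈)) = avoids⇒∉ avoids u∈

  ∉⇒alive : u ∉ A1 ++ ends d A2 → Alive d A1 A2 u
  ∉⇒alive u∉ = u∉ ∘ ∈-++⁺ˡ , ∉⇒avoids A2 (u∉ ∘ ∈-++⁺ʳ A1)
    where
    ∉⇒avoids : ∀ es → u ∉ ends d es → All (λ e → (u ≢ proj₁ e) × (u ≢ proj₂ e)) es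
    ∉⇒avoids []             _   = []
    ∉⇒avoids ((y , z) ∷ es) u∉ = (u∉ ∘ here , u∉ ∘ there ∘ here) ∷ ∉⇒avoids es (u∉ ∘ there ∘ there)

-- The faults of dimension d + 1 as seen from cluster h: vertex faults and edge faults lying in the
-- cluster keep their kind, an edge fault with a single end in the cluster becomes a vertex fault there.
module _ (d : ℕ) (h : Vertex d) where

  inCluster : Vertex (suc d) → Maybe (Vertex d)
  inCluster w with hi d w ≟ᵛ h
  ... | yes _ = just (lo d w)
  ... | no _  = nothing

  crossingEnd : Edge (suc d) → Maybe (Vertex d)
  crossingEnd (y , z) with hi d y ≟ᵛ h | hi d z ≟ᵛ h
  ... | yes _ | no _  = just (lo d y)
  ... | no _  | yes _ = just (lo d z)
  ... | _     | _     = nothing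

  innerEdge : Edge (suc d) → Maybe (Edge d)
  innerEdge (y , z) with hi d y ≟ᵛ h | hi d z ≟ᵛ h
  ... | yes _ | yes _ = just (lo d y , lo d z)
  ... | _     | _     = nothing

  clusterVertexFaults : List (Vertex (suc d)) → List (Edge (suc d)) → List (Vertex d)
  clusterVertexFaults A1 A2 = List.mapMaybe inCluster A1 ++ List.mapMaybe crossingEnd A2

  clusterEdgeFaults : List (Edge (suc d)) → List (Edge d)
  clusterEdgeFaults = List.mapMaybe innerEdge

Avoids : ∀ d → Vertex d → Edge d → Set
Avoids d u (y , z) = u ≢ y × u ≢ z

module _ (d : ℕ) {a h : Vertex d} where

  join≡⇒lo≡ : ∀ {y} → join d a h ≡ y → a ≡ lo d y
  join≡⇒lo≡ refl = sym (lo-join d a h)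

  join≡⇒hi≡ : ∀ {y} → join d a h ≡ y → hi d y ≡ h
  join≡⇒hi≡ refl = hi-join d a h

  lo≡⇒join≡ : ∀ {y} → hi d y ≡ h → a ≡ lo d y → join d a h ≡ y
  lo≡⇒join≡ {y} hi≡ refl = sym (stays-in-cluster d y hi≡)

  inCluster-join : inCluster d h (join d a h) ≡ just a
  inCluster-join with hi d (join d a h) ≟ᵛ h
  ... | yes _   = cong just (lo-join d a h)
  ... | no hi≢ = contradiction (hi-join d a h) hi≢

  inCluster-just : ∀ w → inCluster d h w ≡ just a → join d a h ≡ w
  inCluster-just w eq with hi d w ≟ᵛ h
  inCluster-just w refl | yes hi≡ = lo≡⇒join≡ hi≡ refl

  avoids-cluster⁻ : ∀ e → Avoids (suc d) (join d a h) e →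
                    crossingEnd d h e ≢ just a × (∀ {w} → innerEdge d h e ≡ just w → Avoids d a w)
  avoids-cluster⁻ (y , z) (≢y , ≢z) with hi d y ≟ᵛ h | hi d z ≟ᵛ h
  ... | yes hy | yes hz = (λ ()) , λ { refl → (≢y ∘ lo≡⇒join≡ hy) , (≢z ∘ lo≡⇒join≡ hz) }
  ... | yes hy | no _   = (λ { refl → ≢y (lo≡⇒join≡ hy refl) }) , λ ()
  ... | no _   | yes hz = (λ { refl → ≢z (lo≡⇒join≡ hz refl) }) , λ ()
  ... | no _   | no _   = (λ ()) , λ ()

  avoids-cluster⁺ : ∀ e → crossingEnd d h e ≢ just a → (∀ {w} → innerEdge d h e ≡ just w → Avoids d a w) →
                    Avoids (suc d) (join d a h) e
  avoids-cluster⁺ (y , z) ≢end inner-avoids with hi d y ≟ᵛ h | hi d z ≟ᵛ h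
  ... | yes _ | yes _ = proj₁ (inner-avoids refl) ∘ join≡⇒lo≡ , proj₂ (inner-avoids refl) ∘ join≡⇒lo≡
  ... | yes _ | no hz = ≢end ∘ cong just ∘ sym ∘ join≡⇒lo≡ , hz ∘ join≡⇒hi≡
  ... | no hy | yes _ = hy ∘ join≡⇒hi≡ , ≢end ∘ cong just ∘ sym ∘ join≡⇒lo≡
  ... | no hy | no hz = hy ∘ join≡⇒hi≡ , hz ∘ join≡⇒hi≡

innerEdge-just : ∀ d h e {b c} → innerEdge d h e ≡ just (b , c) → join d b h ≡ proj₁ e × join d c h ≡ proj₂ e
innerEdge-just d h (y , z) eq with hi d y ≟ᵛ h | hi d z ≟ᵛ h
innerEdge-just d h (y , z) refl | yes hy | yes hz = sym (stays-in-cluster d y hy) , sym (stays-in-cluster d z hz)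

module _ (d : ℕ) {A1 : List (Vertex (suc d))} {A2 : List (Edge (suc d))} {a h : Vertex d} where

  alive-cluster⁻ : Alive (suc d) A1 A2 (join d a h) → Alive d (clusterVertexFaults d h A1 A2) (clusterEdgeFaults d h A2) a
  alive-cluster⁻ (∉A1 , avoidsA2) = a∉ , All.tabulate inner-avoids
    where
    a∉ : a ∉ clusterVertexFaults d h A1 A2
    a∉ a∈ with ∈-++⁻ (List.mapMaybe (inCluster d h) A1) a∈
    ... | inj₁ a∈₁ with ∈-mapMaybe⁻ (inCluster d h) A1 a∈₁
    ...   | w , w∈ , eq = ∉A1 (subst (_∈ A1) (sym (inCluster-just d w eq)) w∈)
    a∉ a∈ | inj₂ a∈₂ with ∈-mapMaybe⁻ (crossingEnd d h) A2 a∈₂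
    ...   | e , e∈ , eq = proj₁ (avoids-cluster⁻ d e (All.lookup avoidsA2 e∈)) eq
    inner-avoids : ∀ {w} → w ∈ clusterEdgeFaults d h A2 → Avoids d a w
    inner-avoids w∈ with ∈-mapMaybe⁻ (innerEdge d h) A2 w∈
    ... | e , e∈ , eq = proj₂ (avoids-cluster⁻ d e (All.lookup avoidsA2 e∈)) eq

  alive-cluster⁺ : Alive d (clusterVertexFaults d h A1 A2) (clusterEdgeFaults d h A2) a → Alive (suc d) A1 A2 (join d a h)
  alive-cluster⁺ (a∉ , avoidsE) =
    (λ j∈ → a∉ (∈-++⁺ˡ (∈-mapMaybe⁺ (inCluster d h) j∈ (inCluster-join d)))) ,
    All.tabulate (λ {e} e∈ → avoids-cluster⁺ d e
      (λ eq → a∉ (∈-++⁺ʳ (List.mapMaybe (inCluster d h) A1) (∈-mapMaybe⁺ (crossingEnd d h) e∈ eq)))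
      (λ eq → All.lookup avoidsE (∈-mapMaybe⁺ (innerEdge d h) e∈ eq)))

adj-clusterEdges : ∀ e (h : Vertex (suc e)) {A2 : List (Edge (suc (suc e)))} →
                   AllAdjacent (suc (suc e)) A2 → AllAdjacent (suc e) (clusterEdgeFaults (suc e) h A2)
adj-clusterEdges e h {A2} adjs = All.tabulate λ {w} w∈ → inner w (∈-mapMaybe⁻ (innerEdge (suc e) h) A2 w∈)
  where
  inner : ∀ w → (∃ λ f → f ∈ A2 × innerEdge (suc e) h f ≡ just w) → Adj (suc e) (proj₁ w) (proj₂ w)
  inner (b , c) (f , f∈ , eq) with innerEdge-just (suc e) h f eq
  ... | refl , refl = adj-within e (All.lookup adjs f∈)

module _ (d : ℕ) (h : Vertex d) where

  inCluster-nothing : ∀ {w} → hi d w ≢ h → inCluster d h w ≡ nothing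
  inCluster-nothing {w} hi≢ with hi d w ≟ᵛ h
  ... | yes hi≡ = contradiction hi≡ hi≢
  ... | no _    = refl

  crossingEnd-nothing : ∀ {y z} → hi d y ≢ h → hi d z ≢ h → crossingEnd d h (y , z) ≡ nothing
  crossingEnd-nothing {y} {z} hy hz with hi d y ≟ᵛ h | hi d z ≟ᵛ h
  ... | yes hy′ | _       = contradiction hy′ hy
  ... | no _    | yes hz′ = contradiction hz′ hz
  ... | no _    | no _    = refl

  innerEdge-nothing : ∀ {y z} → ¬ (hi d y ≡ h × hi d z ≡ h) → innerEdge d h (y , z) ≡ nothing
  innerEdge-nothing {y} {z} ¬inner with hi d y ≟ᵛ h | hi d z ≟ᵛ h
  ... | yes hy | yes hz = contradiction (hy , hz) ¬inner
  ... | yes _  | no _   = refl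
  ... | no _   | yes _  = refl
  ... | no _   | no _   = refl

  edge-traces-disjoint : ∀ e → crossingEnd d h e ≡ nothing ⊎ innerEdge d h e ≡ nothing
  edge-traces-disjoint (y , z) with hi d y ≟ᵛ h | hi d z ≟ᵛ h
  ... | yes _ | yes _ = inj₁ refl
  ... | yes _ | no _  = inj₂ refl
  ... | no _  | yes _ = inj₂ refl
  ... | no _  | no _  = inj₁ refl

  clusterFaultCount : List (Vertex (suc d)) → List (Edge (suc d)) → ℕ
  clusterFaultCount A1 A2 = length (clusterVertexFaults d h A1 A2) + length (clusterEdgeFaults d h A2)

  module _ (A1 : List (Vertex (suc d))) (A2 : List (Edge (suc d))) where

    private
      #V = length (List.mapMaybe (inCluster d h) A1)
      #E = length (List.mapMaybe (crossingEnd d h) A2) + length (List.mapMaybe (innerEdge d h) A2)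

      count≡ : clusterFaultCount A1 A2 ≡ #V + #E
      count≡ = trans (cong (_+ _) (length-++ (List.mapMaybe (inCluster d h) A1))) (+-assoc #V _ _)

      #E≤ : #E ≤ length A2
      #E≤ = length-mapMaybe₂-≤ (crossingEnd d h) (innerEdge d h) edge-traces-disjoint A2

    clusterFaultCount-<ᵛ : ∀ {w} → w ∈ A1 → hi d w ≢ h → clusterFaultCount A1 A2 < length A1 + length A2
    clusterFaultCount-<ᵛ w∈ hi≢ = subst (_< length A1 + length A2) (sym count≡)
      (+-mono-<-≤ (length-mapMaybe-< (inCluster d h) w∈ (inCluster-nothing hi≢)) #E≤)

    clusterFaultCount-<ᵉ : ∀ {y z} → (y , z) ∈ A2 → hi d y ≢ h → hi d z ≢ h → clusterFaultCount A1 A2 < length A1 + length A2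
    clusterFaultCount-<ᵉ e∈ hy hz = subst (_< length A1 + length A2) (sym count≡)
      (+-mono-≤-< (length-mapMaybe-≤ (inCluster d h) A1)
        (length-mapMaybe₂-< (crossingEnd d h) (innerEdge d h) edge-traces-disjoint e∈
          (crossingEnd-nothing hy hz) (innerEdge-nothing (hy ∘ proj₁))))

    private
      no-vertex-traces : (∀ {w} → w ∈ A1 → hi d w ≢ h) → List.mapMaybe (inCluster d h) A1 ≡ []
      no-vertex-traces A1-misses = mapMaybe-≡[] (inCluster d h) A1 (inCluster-nothing ∘ A1-misses)

      no-crossing-traces : (∀ {y z} → (y , z) ∈ A2 → hi d y ≢ h × hi d z ≢ h) → List.mapMaybe (crossingEnd d h) A2 ≡ []
      no-crossing-traces A2-misses =
        mapMaybe-≡[] (crossingEnd d h) A2 (λ {(y , z)} e∈ → crossingEnd-nothing (proj₁ (A2-misses e∈)) (proj₂ (A2-misses e∈)))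

      no-inner-traces : (∀ {y z} → (y , z) ∈ A2 → ¬ (hi d y ≡ h × hi d z ≡ h)) → clusterEdgeFaults d h A2 ≡ []
      no-inner-traces A2-not-inner = mapMaybe-≡[] (innerEdge d h) A2 (λ {(y , z)} e∈ → innerEdge-nothing (A2-not-inner e∈))

    clusterFaultCount-no-vertices : (∀ {w} → w ∈ A1 → hi d w ≢ h) →
                                    (∀ {y z} → (y , z) ∈ A2 → ¬ (hi d y ≡ h × hi d z ≡ h)) →
                                    clusterFaultCount A1 A2 ≤ length A2 × clusterEdgeFaults d h A2 ≡ []
    clusterFaultCount-no-vertices A1-misses A2-not-inner =
      subst (_≤ length A2) (sym (trans count≡ (cong (λ V → length V + #E) (no-vertex-traces A1-misses)))) #E≤ ,
      no-inner-traces A2-not-inner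

    clusterFaultCount-no-edges : (∀ {y z} → (y , z) ∈ A2 → hi d y ≢ h × hi d z ≢ h) →
                                 clusterFaultCount A1 A2 ≤ length A1 × clusterEdgeFaults d h A2 ≡ []
    clusterFaultCount-no-edges A2-misses =
      subst (_≤ length A1) (sym (trans count≡ (cong₂ (λ C E → #V + (length C + length E)) noC noE)))
            (≤-trans (≤-reflexive (+-identityʳ #V)) (length-mapMaybe-≤ (inCluster d h) A1)) ,
      noE
      where
      noC = no-crossing-traces A2-misses
      noE = no-inner-traces (λ e∈ → proj₁ (A2-misses e∈) ∘ proj₁)

    clusterFaultCount-untouched : (∀ {w} → w ∈ A1 → hi d w ≢ h) →
                                  (∀ {y z} → (y , z) ∈ A2 → hi d y ≢ h × hi d z ≢ h) →
                                  clusterFaultCount A1 A2 ≡ 0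
    clusterFaultCount-untouched A1-misses A2-misses =
      trans count≡ (cong₂ (λ V (C , E) → length V + (length C + length E)) (no-vertex-traces A1-misses)
                          (cong₂ _,_ (no-crossing-traces A2-misses) (no-inner-traces (λ e∈ → proj₁ (A2-misses e∈) ∘ proj₁))))

    all-faults-in-cluster : length A1 + length A2 ≤ clusterFaultCount A1 A2 →
                            (∀ {w} → w ∈ A1 → hi d w ≡ h) × (∀ {y z} → (y , z) ∈ A2 → hi d y ≡ h ⊎ hi d z ≡ h)
    all-faults-in-cluster all≤ = vertex-in , edge-meets
      where
      vertex-in : ∀ {w} → w ∈ A1 → hi d w ≡ h
      vertex-in {w} w∈ with hi d w ≟ᵛ h
      ... | yes hi≡ = hi≡
      ... | no hi≢  = contradiction all≤ (<⇒≱ (clusterFaultCount-<ᵛ w∈ hi≢))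
      edge-meets : ∀ {y z} → (y , z) ∈ A2 → hi d y ≡ h ⊎ hi d z ≡ h
      edge-meets {y} {z} e∈ with hi d y ≟ᵛ h | hi d z ≟ᵛ h
      ... | yes hy | _      = inj₁ hy
      ... | no _   | yes hz = inj₂ hz
      ... | no hy  | no hz  = contradiction all≤ (<⇒≱ (clusterFaultCount-<ᵉ e∈ hy hz))

    all-edges-inside-cluster : length A2 ≤ length (clusterEdgeFaults d h A2) →
                               ∀ {y z} → (y , z) ∈ A2 → hi d y ≡ h × hi d z ≡ h
    all-edges-inside-cluster all≤ {y} {z} e∈ with hi d y ≟ᵛ h | hi d z ≟ᵛ h
    ... | yes hy | yes hz = hy , hz
    ... | yes hy | no hz  = contradiction all≤ (<⇒≱ (length-mapMaybe-< (innerEdge d h) e∈ (innerEdge-nothing (hz ∘ proj₂))))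
    ... | no hy  | _      = contradiction all≤ (<⇒≱ (length-mapMaybe-< (innerEdge d h) e∈ (innerEdge-nothing (hy ∘ proj₁))))

-- Every survivor has a surviving neighbour

NoIsolatedSurvivor : ℕ → Set
NoIsolatedSurvivor d = ∀ (A1 : List (Vertex d)) (A2 : List (Edge d)) → AllAdjacent d A2 →
                       length A1 + length A2 ≤ d → ∀ x → Alive d A1 A2 x → ∃ λ y → Adj d x y × Alive d A1 A2 y

noIsolatedSurvivor₁ : NoIsolatedSurvivor 1
noIsolatedSurvivor₁ A1 A2 _ count≤ x _ with ∃-∉ 2 (x ∷ A1 ++ ends 1 A2) few-faulty
  where
  few-faulty : suc (length (A1 ++ ends 1 A2)) < 4
  few-faulty = subst (λ n → suc n < 4) (sym (length-faulty 1 A1 A2))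
                     (s≤s (s≤s (+-mono-≤ count≤ (≤-trans (m≤n+m (length A2) (length A1)) count≤))))
... | y , y∉ = y , adj-complete₁ x y (λ x≡y → y∉ (here (sym x≡y))) , ∉⇒alive (y∉ ∘ there)

module _ (e : ℕ) {A1 : List (Vertex (suc (suc e)))} {A2 : List (Edge (suc (suc e)))}
         (adjacent : AllAdjacent (suc (suc e)) A2) where

  private
    d = suc e
    D = suc d

    other-end-misses : ∀ x {z} → Adj D (topSwap d x) z → x ≢ z → hi d z ≢ hi d x
    other-end-misses x {z} x̃~z x≢z hi≡ = x≢z (begin
      x                           ≡⟨ topSwap-involutive d x ⟨
      topSwap d (topSwap d x)     ≡⟨ adj-across e x̃~z (λ hi≡′ → hi-topSwap d x (trans (sym hi≡′) hi≡)) ⟨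
      z                           ∎)
      where open ≡-Reasoning

  faulty-swap⇒light-cluster : ∀ {x} → Alive D A1 A2 x → topSwap d x ∈ A1 ++ ends D A2 →
                              clusterFaultCount d (hi d x) A1 A2 < length A1 + length A2
  faulty-swap⇒light-cluster {x} (_ , x-avoids) x̃∈ with ∈-++⁻ A1 x̃∈
  ... | inj₁ x̃∈A1 = clusterFaultCount-<ᵛ d (hi d x) A1 A2 x̃∈A1 (hi-topSwap d x)
  ... | inj₂ x̃∈ends with ∈-ends⁻ D A2 x̃∈ends
  ...   | (y , z) , e∈ , inj₁ refl =
    clusterFaultCount-<ᵉ d (hi d x) A1 A2 e∈ (hi-topSwap d x)
      (other-end-misses x (All.lookup adjacent e∈) (proj₂ (All.lookup x-avoids e∈)))
  ...   | (y , z) , e∈ , inj₂ refl =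
    clusterFaultCount-<ᵉ d (hi d x) A1 A2 e∈
      (other-end-misses x (adj-sym (All.lookup adjacent e∈)) (proj₁ (All.lookup x-avoids e∈))) (hi-topSwap d x)

  neighbour-in-cluster : NoIsolatedSurvivor d → ∀ {x} → clusterFaultCount d (hi d x) A1 A2 ≤ d → Alive D A1 A2 x →
                         ∃ λ y → Adj D x y × Alive D A1 A2 y × hi d y ≡ hi d x
  neighbour-in-cluster noIsolated {x} count≤ x-alive
    with noIsolated _ _ (adj-clusterEdges e h adjacent) count≤ (lo d x)
                    (alive-cluster⁻ d (subst (Alive D A1 A2) (sym (join-lo-hi d x)) x-alive))
    where h = hi d x
  ... | a′ , a~a′ , a′-alive =
    join d a′ (hi d x) ,
    subst (λ w → Adj D w (join d a′ (hi d x))) (join-lo-hi d x) (adj-inner e (hi d x) a~a′) ,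
    alive-cluster⁺ d a′-alive ,
    hi-join d a′ (hi d x)

noIsolatedSurvivor-step : ∀ e → NoIsolatedSurvivor (suc e) → NoIsolatedSurvivor (suc (suc e))
noIsolatedSurvivor-step e noIsolated A1 A2 adjacent count≤ x x-alive
  with Membership._∈?_ _≟ᵛ_ (topSwap (suc e) x) (A1 ++ ends (suc (suc e)) A2)
... | no x̃∉  = topSwap (suc e) x , adj-topSwap (suc e) x , ∉⇒alive x̃∉
... | yes x̃∈ with neighbour-in-cluster e adjacent noIsolated
                    (≤-pred (≤-trans (faulty-swap⇒light-cluster e adjacent x-alive x̃∈) count≤)) x-alive
...   | y , x~y , y-alive , _ = y , x~y , y-alive

noIsolatedSurvivor : ∀ e → NoIsolatedSurvivor (suc e)
noIsolatedSurvivor zero    = noIsolatedSurvivor₁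
noIsolatedSurvivor (suc e) = noIsolatedSurvivor-step e (noIsolatedSurvivor e)

-- The inductive step

FaultTolerant : ℕ → Set
FaultTolerant d = ∀ (A1 : List (Vertex d)) (A2 : List (Edge d)) → AllAdjacent d A2 →
                  length A1 + length A2 ≤ d → length A2 ≤ d ∸ 1 → Connected d (Alive d A1 A2)

halves : ∀ d → List (Vertex (suc d)) → List (Vertex d)
halves d []       = []
halves d (w ∷ ws) = lo d w ∷ hi d w ∷ halves d ws

length-halves : ∀ d (ws : List (Vertex (suc d))) → length (halves d ws) ≡ length ws + length ws
length-halves d []       = refl
length-halves d (w ∷ ws) = cong suc (trans (cong suc (length-halves d ws)) (sym (+-suc (length ws) (length ws))))

∈-halves : ∀ d {w} {ws : List (Vertex (suc d))} → w ∈ ws → lo d w ∈ halves d ws × hi d w ∈ halves d ws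
∈-halves d (here refl)              = here refl , there (here refl)
∈-halves d {ws = _ ∷ _} (there w∈) = map (there ∘ there) (there ∘ there) (∈-halves d w∈)

n+2≤2^n : ∀ k → suc (suc (suc (suc k))) ≤ 2 ^ suc (suc k)
n+2≤2^n zero    = ≤-refl
n+2≤2^n (suc k) = subst (_≤ 2 ^ suc (suc (suc k))) (+-comm (suc (suc (suc (suc k)))) 1)
                        (+-mono-≤ (n+2≤2^n k) (≤-trans (m^n>0 2 (suc (suc k))) (m≤m+n _ 0)))

room-for-hub : ∀ k → let d = suc (suc k) in (suc d + d) + (suc d + d) < 2 ^ (2 ^ d)
room-for-hub k = begin-strict
  (suc d + d) + (suc d + d) <⟨ +-mono-< half< half< ⟩
  (m + m) + (m + m)         ≡⟨ cong₂ _+_ double (trans double (sym (+-identityʳ (m + (m + 0))))) ⟩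
  2 ^ suc (suc d)           ≤⟨ ^-monoʳ-≤ 2 (n+2≤2^n k) ⟩
  2 ^ m                     ∎
  where
  open ≤-Reasoning
  d = suc (suc k)
  m = 2 ^ d
  double : m + m ≡ m + (m + 0)
  double = cong (m +_) (sym (+-identityʳ m))
  half< : suc d + d < m + m
  half< = +-mono-<-≤ (n+2≤2^n k) (≤-trans (n≤1+n d) (≤-trans (n≤1+n (suc d)) (n+2≤2^n k)))

module InductiveStep (k : ℕ) (ih : FaultTolerant (suc (suc k)))
         (A1 : List (Vertex (suc (suc (suc k))))) (A2 : List (Edge (suc (suc (suc k)))))
         (adjacent : AllAdjacent (suc (suc (suc k))) A2)
         (count≤ : length A1 + length A2 ≤ suc (suc (suc k))) (edges≤ : length A2 ≤ suc (suc k)) where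

  private
    e = suc k
    d = suc e
    D = suc d
    Survivor = Alive D A1 A2

  Good : Vertex d → Set
  Good h = clusterFaultCount d h A1 A2 ≤ d × length (clusterEdgeFaults d h A2) ≤ d ∸ 1

  walk-in-good-cluster : ∀ h → Good h → ∀ a b → Survivor (join d a h) → Survivor (join d b h) →
                         Walk D Survivor (join d a h) (join d b h)
  walk-in-good-cluster h (count≤ʰ , edges≤ʰ) a b a-alive b-alive =
    walk-join e h (alive-cluster⁺ d)
      (ih _ _ (adj-clusterEdges e h adjacent) count≤ʰ edges≤ʰ a b (alive-cluster⁻ d a-alive) (alive-cluster⁻ d b-alive))

  good-if-no-vertex-faults : ∀ {h} → (∀ {w} → w ∈ A1 → hi d w ≢ h) →
                             (∀ {y z} → (y , z) ∈ A2 → ¬ (hi d y ≡ h × hi d z ≡ h)) → Good h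
  good-if-no-vertex-faults A1-misses A2-not-inner with clusterFaultCount-no-vertices d _ A1 A2 A1-misses A2-not-inner
  ... | count≤ʰ , noE = ≤-trans count≤ʰ edges≤ , subst (λ E → length E ≤ d ∸ 1) (sym noE) z≤n

  good-if-no-edge-faults : ∀ {h} → length A1 ≤ 1 → (∀ {y z} → (y , z) ∈ A2 → hi d y ≢ h × hi d z ≢ h) → Good h
  good-if-no-edge-faults |A1|≤1 A2-misses with clusterFaultCount-no-edges d _ A1 A2 A2-misses
  ... | count≤ʰ , noE = ≤-trans count≤ʰ (≤-trans |A1|≤1 (s≤s z≤n)) , subst (λ E → length E ≤ d ∸ 1) (sym noE) z≤n

  private
    faulty = A1 ++ ends D A2

    hub-half : ∃ λ z → z ∉ halves d faulty
    hub-half = ∃-∉ (2 ^ d) (halves d faulty) (begin-strict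
      length (halves d faulty)                    ≡⟨ length-halves d faulty ⟩
      length faulty + length faulty               ≡⟨ cong (λ n → n + n) (length-faulty D A1 A2) ⟩
      (length A1 + length A2 + length A2) + (length A1 + length A2 + length A2)
                                                  ≤⟨ +-mono-≤ few few ⟩
      (suc d + d) + (suc d + d)                   <⟨ room-for-hub k ⟩
      2 ^ (2 ^ d)                                 ∎)
      where
      open ≤-Reasoning
      few = +-mono-≤ count≤ edges≤

    z = proj₁ hub-half

    z-unused : ∀ {w} → w ∈ faulty → lo d w ≢ z × hi d w ≢ z
    z-unused w∈ = (λ lo≡z → proj₂ hub-half (subst (_∈ halves d faulty) lo≡z (proj₁ (∈-halves d w∈)))) ,
                  (λ hi≡z → proj₂ hub-half (subst (_∈ halves d faulty) hi≡z (proj₂ (∈-halves d w∈))))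

    survivor-if-half-is-z : ∀ {u} → lo d u ≡ z ⊎ hi d u ≡ z → Survivor u
    survivor-if-half-is-z (inj₁ lo≡z) = ∉⇒alive (λ u∈ → proj₁ (z-unused u∈) lo≡z)
    survivor-if-half-is-z (inj₂ hi≡z) = ∉⇒alive (λ u∈ → proj₂ (z-unused u∈) hi≡z)

    good-z : Good z
    good-z = subst (_≤ d) (sym count≡0) z≤n ,
             subst (_≤ d ∸ 1) (sym (m+n≡0⇒n≡0 (length (clusterVertexFaults d z A1 A2)) count≡0)) z≤n
      where
      count≡0 : clusterFaultCount d z A1 A2 ≡ 0
      count≡0 = clusterFaultCount-untouched d z A1 A2 (proj₂ ∘ z-unused ∘ ∈-++⁺ˡ)
                  (λ e∈ → map (proj₂ ∘ z-unused ∘ ∈-++⁺ʳ A1) (proj₂ ∘ z-unused ∘ ∈-++⁺ʳ A1) (∈-ends⁺ D e∈))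

  hub : Vertex D
  hub = join d z z

  to-hub-from-good-cluster : ∀ {x} → Survivor x → Good (hi d x) → Walk D Survivor x hub
  to-hub-from-good-cluster {x} x-alive good with hi d x ≟ᵛ z
  ... | yes hi≡z = subst₂ (Walk D Survivor) (join-lo-hi d x) (cong (join d z) hi≡z)
                     (walk-in-good-cluster (hi d x) good (lo d x) z x-alive′ (survivor-if-half-is-z (inj₁ (lo-join d z (hi d x)))))
    where x-alive′ = subst Survivor (sym (join-lo-hi d x)) x-alive
  ... | no hi≢z = subst (λ v → Walk D Survivor v hub) (join-lo-hi d x)
                    (walk-in-good-cluster h good (lo d x) z x-alive′ zh-alive ▻ step zh-alive zh~hz
                      (walk-in-good-cluster z good-z h z (survivor-if-half-is-z (inj₂ (hi-join d h z)))
                                                   (survivor-if-half-is-z (inj₁ (lo-join d z z)))))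
    where
    h = hi d x
    x-alive′ = subst Survivor (sym (join-lo-hi d x)) x-alive
    zh-alive = survivor-if-half-is-z (inj₁ (lo-join d z h))
    zh~hz : Adj D (join d z h) (join d h z)
    zh~hz = subst (Adj D (join d z h)) (trans (topSwap-join d z h) (swapHalves-≢ d (hi≢z ∘ sym))) (adj-topSwap d (join d z h))

  Escape : Vertex D → Set
  Escape x = ∃ λ y → Walk D Survivor x y × Good (hi d y)

  -- Every fault meets cluster hi x: topSwap x survives and no other cluster contains a vertex fault.
  escape-heavy-cluster : ∀ {x} → Survivor x → ¬ clusterFaultCount d (hi d x) A1 A2 ≤ d → Escape x
  escape-heavy-cluster {x} x-alive heavy =
    topSwap d x , step x-alive (adj-topSwap d x) (here x̃-alive) ,
    good-if-no-vertex-faults (λ w∈ hi≡ → hi-topSwap d x (trans (sym hi≡) (in-cluster w∈)))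
                             (λ e∈ (hy , hz) → [ (λ hy′ → hi-topSwap d x (trans (sym hy) hy′)) ,
                                                 (λ hz′ → hi-topSwap d x (trans (sym hz) hz′)) ]′ (meets-cluster e∈))
    where
    all≤ : length A1 + length A2 ≤ clusterFaultCount d (hi d x) A1 A2
    all≤ = ≤-trans count≤ (≰⇒> heavy)
    in-cluster = proj₁ (all-faults-in-cluster d (hi d x) A1 A2 all≤)
    meets-cluster = proj₂ (all-faults-in-cluster d (hi d x) A1 A2 all≤)
    x̃-alive : Survivor (topSwap d x)
    x̃-alive = ∉⇒alive (λ x̃∈ → <⇒≱ (faulty-swap⇒light-cluster e adjacent x-alive x̃∈) all≤)

  -- Every edge fault lies inside cluster hi x and at most one vertex fault is left. If it is topSwap x,
  -- go first to a neighbour y of x in the cluster, whose swap differs from topSwap x.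
  escape-saturated-cluster : ∀ {x} → Survivor x → clusterFaultCount d (hi d x) A1 A2 ≤ d →
                             ¬ length (clusterEdgeFaults d (hi d x) A2) ≤ d ∸ 1 → Escape x
  escape-saturated-cluster {x} x-alive count≤ʰ saturated = escape (Membership._∈?_ _≟ᵛ_ (topSwap d x) (A1 ++ ends D A2))
    where
    h = hi d x

    d≤|A2| : d ≤ length A2
    d≤|A2| = ≤-trans (≰⇒> saturated) (length-mapMaybe-≤ (innerEdge d h) A2)

    inside : ∀ {y z} → (y , z) ∈ A2 → hi d y ≡ h × hi d z ≡ h
    inside = all-edges-inside-cluster d h A1 A2 (≤-trans edges≤ (≰⇒> saturated))

    |A1|≤1 : length A1 ≤ 1
    |A1|≤1 = +-cancelʳ-≤ d (length A1) 1 (≤-trans (+-monoʳ-≤ (length A1) d≤|A2|) count≤)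

    good-off-cluster : ∀ {h′} → h′ ≢ h → Good h′
    good-off-cluster h′≢h = good-if-no-edge-faults |A1|≤1 λ e∈ →
      (λ hy′ → h′≢h (trans (sym hy′) (proj₁ (inside e∈)))) , (λ hz′ → h′≢h (trans (sym hz′) (proj₂ (inside e∈))))

    swap-faulty⇒∈A1 : ∀ {w} → hi d w ≡ h → topSwap d w ∈ A1 ++ ends D A2 → topSwap d w ∈ A1
    swap-faulty⇒∈A1 {w} hi≡ w̃∈ with ∈-++⁻ A1 w̃∈
    ... | inj₁ w̃∈A1  = w̃∈A1
    ... | inj₂ w̃∈ends with ∈-ends⁻ D A2 w̃∈ends
    ...   | (y , z) , e∈ , inj₁ refl = contradiction (trans (proj₁ (inside e∈)) (sym hi≡)) (hi-topSwap d w)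
    ...   | (y , z) , e∈ , inj₂ refl = contradiction (trans (proj₂ (inside e∈)) (sym hi≡)) (hi-topSwap d w)

    escape : Dec (topSwap d x ∈ A1 ++ ends D A2) → Escape x
    escape (no x̃∉) = topSwap d x , step x-alive (adj-topSwap d x) (here (∉⇒alive x̃∉)) , good-off-cluster (hi-topSwap d x)
    escape (yes x̃∈) with neighbour-in-cluster e adjacent (noIsolatedSurvivor e) count≤ʰ x-alive
    ... | y , x~y , y-alive , hi≡ =
      topSwap d y , step x-alive x~y (step y-alive (adj-topSwap d y) (here ỹ-alive)) ,
      good-off-cluster (λ hi≡′ → hi-topSwap d y (trans hi≡′ (sym hi≡)))
      where
      ỹ-alive : Survivor (topSwap d y)
      ỹ-alive = ∉⇒alive λ ỹ∈ → adj-irrefl (subst (Adj D x) (topSwap-injective d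
        (∈-length≤1-unique |A1|≤1 (swap-faulty⇒∈A1 hi≡ ỹ∈) (swap-faulty⇒∈A1 refl x̃∈))) x~y)

  to-hub-via : ∀ {x} → Escape x → Walk D Survivor x hub
  to-hub-via (y , x⇝y , good) = x⇝y ▻ to-hub-from-good-cluster (walk-target x⇝y) good

  to-hub : ∀ x → Survivor x → Walk D Survivor x hub
  to-hub x x-alive with clusterFaultCount d (hi d x) A1 A2 ≤? d | length (clusterEdgeFaults d (hi d x) A2) ≤? d ∸ 1
  ... | yes count≤ʰ | yes edges≤ʰ = to-hub-from-good-cluster x-alive (count≤ʰ , edges≤ʰ)
  ... | no heavy    | _            = to-hub-via (escape-heavy-cluster x-alive heavy)
  ... | yes count≤ʰ | no saturated = to-hub-via (escape-saturated-cluster x-alive count≤ʰ saturated)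

faultTolerant-step : ∀ k → FaultTolerant (suc (suc k)) → FaultTolerant (suc (suc (suc k)))
faultTolerant-step k ih A1 A2 adjacent count≤ edges≤ =
  connected-via hub to-hub
  where open InductiveStep k ih A1 A2 adjacent count≤ edges≤

-- The base case d = 2

allVectors : ∀ n → List (Vec Bool n)
allVectors zero    = Vec.[] ∷ []
allVectors (suc n) = List.map (true Vec.∷_) (allVectors n) ++ List.map (false Vec.∷_) (allVectors n)

∈-allVectors : ∀ {n} (v : Vec Bool n) → v ∈ allVectors n
∈-allVectors Vec.[]            = here refl
∈-allVectors (true Vec.∷ v)    = ∈-++⁺ˡ (∈-map⁺ (true Vec.∷_) (∈-allVectors v))
∈-allVectors {suc n} (false Vec.∷ v) = ∈-++⁺ʳ (List.map (true Vec.∷_) (allVectors n)) (∈-map⁺ (false Vec.∷_) (∈-allVectors v))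

tuples : ∀ {A : Set} → ℕ → List A → List (List A)
tuples zero    xs = [] ∷ []
tuples (suc n) xs = List.cartesianProductWith _∷_ xs (tuples n xs)

∈-tuples : ∀ {A : Set} {xs : List A} (S : List A) → (∀ {x} → x ∈ S → x ∈ xs) → S ∈ tuples (length S) xs
∈-tuples []      _  = here refl
∈-tuples (x ∷ S) S⊆ = ∈-cartesianProductWith⁺ _∷_ (S⊆ (here refl)) (∈-tuples S (S⊆ ∘ there))

tuplesUpTo : ∀ {A : Set} → ℕ → List A → List (List A)
tuplesUpTo zero    xs = tuples zero xs
tuplesUpTo (suc n) xs = tuplesUpTo n xs ++ tuples (suc n) xs

∈-tuplesUpTo : ∀ {A : Set} {xs : List A} n (S : List A) → length S ≤ n → (∀ {x} → x ∈ S → x ∈ xs) → S ∈ tuplesUpTo n xs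
∈-tuplesUpTo zero    []      _  _ = here refl
∈-tuplesUpTo zero    (_ ∷ _) ()
∈-tuplesUpTo {xs = xs} (suc n) S |S|≤n S⊆ with m≤n⇒m<n∨m≡n |S|≤n
... | inj₁ |S|<  = ∈-++⁺ˡ (∈-tuplesUpTo n S (≤-pred |S|<) S⊆)
... | inj₂ |S|≡ = ∈-++⁺ʳ (tuplesUpTo n xs) (subst (λ m → S ∈ tuples m xs) |S|≡ (∈-tuples S S⊆))

T-all : ∀ {A : Set} (p : A → Bool) {x} xs → T (all p xs) → x ∈ xs → T (p x)
T-all p (x ∷ xs) T∧ (here refl) = proj₁ (Equivalence.to T-∧ T∧)
T-all p (y ∷ xs) T∧ (there x∈) = T-all p xs (proj₂ (Equivalence.to T-∧ T∧)) x∈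

T-any : ∀ {A : Set} (p : A → Bool) xs → T (any p xs) → ∃ λ x → x ∈ xs × T (p x)
T-any p (x ∷ xs) T∨ with Equivalence.to (T-∨ {p x}) T∨
... | inj₁ px = x , here refl , px
... | inj₂ T∨′ = map₂ (map₁ there) (T-any p xs T∨′)

-- Boolean functions on bit vectors, tabulated so that each round of the search below is computed once.
data Table : ℕ → Set where
  leaf : Bool → Table zero
  node : ∀ {n} → Table n → Table n → Table (suc n)

lookup : ∀ {n} → Table n → Vec Bool n → Bool
lookup (leaf b)   Vec.[]            = b
lookup (node t f) (true Vec.∷ v)    = lookup t v
lookup (node t f) (false Vec.∷ v)   = lookup f v

tabulate : ∀ {n} → (Vec Bool n → Bool) → Table n
tabulate {zero}  p = leaf (p Vec.[])
tabulate {suc n} p = node (tabulate (p ∘ (true Vec.∷_))) (tabulate (p ∘ (false Vec.∷_)))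

lookup-tabulate : ∀ {n} (p : Vec Bool n → Bool) v → lookup (tabulate p) v ≡ p v
lookup-tabulate p Vec.[]          = refl
lookup-tabulate p (true Vec.∷ v)  = lookup-tabulate (p ∘ (true Vec.∷_)) v
lookup-tabulate p (false Vec.∷ v) = lookup-tabulate (p ∘ (false Vec.∷_)) v

neighbours₂ : Vertex 2 → List (Vertex 2)
neighbours₂ u@(a Vec.∷ b Vec.∷ c Vec.∷ e Vec.∷ Vec.[]) =
  (not a Vec.∷ b Vec.∷ c Vec.∷ e Vec.∷ Vec.[]) ∷ (a Vec.∷ not b Vec.∷ c Vec.∷ e Vec.∷ Vec.[]) ∷
  (not a Vec.∷ not b Vec.∷ c Vec.∷ e Vec.∷ Vec.[]) ∷ topSwap 1 u ∷ []

∈-neighbours₂⁺ : ∀ {u v} → Adj 2 u v → v ∈ neighbours₂ u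
∈-neighbours₂⁺ {a Vec.∷ b Vec.∷ c Vec.∷ e Vec.∷ Vec.[]} u~v with adj-join-cases 0 (a Vec.∷ b Vec.∷ Vec.[]) (c Vec.∷ e Vec.∷ Vec.[]) u~v
... | inj₂ refl = there (there (there (here refl)))
... | inj₁ (a′ Vec.∷ b′ Vec.∷ Vec.[] , refl , ab~a′b′) with a′ ≟ᵇ a | b′ ≟ᵇ b
...   | yes refl | yes refl = contradiction ab~a′b′ adj-irrefl
...   | no a′≢a  | yes refl = here (cong (λ x → x Vec.∷ b Vec.∷ c Vec.∷ e Vec.∷ Vec.[]) (¬-not a′≢a))
...   | yes refl | no b′≢b  = there (here (cong (λ y → a Vec.∷ y Vec.∷ c Vec.∷ e Vec.∷ Vec.[]) (¬-not b′≢b)))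
...   | no a′≢a  | no b′≢b  =
  there (there (here (cong₂ (λ x y → x Vec.∷ y Vec.∷ c Vec.∷ e Vec.∷ Vec.[]) (¬-not a′≢a) (¬-not b′≢b))))

∈-neighbours₂⁻ : ∀ {u v} → v ∈ neighbours₂ u → Adj 2 u v
∈-neighbours₂⁻ {a Vec.∷ b Vec.∷ c Vec.∷ e Vec.∷ Vec.[]} (here refl)                 = adj1 refl
∈-neighbours₂⁻ {a Vec.∷ b Vec.∷ c Vec.∷ e Vec.∷ Vec.[]} (there (here refl))         = adj3 refl
∈-neighbours₂⁻ {a Vec.∷ b Vec.∷ c Vec.∷ e Vec.∷ Vec.[]} (there (there (here refl))) =
  adj-inner 0 (c Vec.∷ e Vec.∷ Vec.[]) (adj-complete₁ (a Vec.∷ b Vec.∷ Vec.[]) (not a Vec.∷ not b Vec.∷ Vec.[]) (not-¬ refl ∘ cong Vec.head))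
∈-neighbours₂⁻ {u@(_ Vec.∷ _ Vec.∷ _ Vec.∷ _ Vec.∷ Vec.[])} (there (there (there (here refl)))) = adj-topSwap 1 u

module Reachability (S : List (Vertex 2)) where

  survives : Vertex 2 → Bool
  survives v = not (does (Membership._∈?_ _≟ᵛ_ v S))

  T-survives : ∀ {v} → T (survives v) → v ∉ S
  T-survives {v} T-v with Membership._∈?_ _≟ᵛ_ v S
  ... | no v∉ = v∉

  survives-T : ∀ {v} → v ∉ S → T (survives v)
  survives-T {v} v∉ with Membership._∈?_ _≟ᵛ_ v S
  ... | yes v∈ = v∉ v∈
  ... | no _   = _

  root : Vertex 2
  root = List.foldr (λ v r → if survives v then v else r) (Vec.replicate 4 false) (allVectors 4)

  -- Opaque, so that type checking never unfolds reachedWithin n to its exponentially large normal form;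
  -- only the exhaustive checks below unfold it.
  opaque
    grow : Table 4 → Table 4
    grow R = tabulate λ v → lookup R v ∨ (survives v ∧ any (lookup R) (neighbours₂ v))

    lookup-grow : ∀ R v → lookup (grow R) v ≡ (lookup R v ∨ (survives v ∧ any (lookup R) (neighbours₂ v)))
    lookup-grow R v = lookup-tabulate (λ v → lookup R v ∨ (survives v ∧ any (lookup R) (neighbours₂ v))) v

  reachedWithin : ℕ → Table 4
  reachedWithin zero    = tabulate λ v → does (v ≟ᵛ root)
  reachedWithin (suc n) = grow (reachedWithin n)

  -- Six rounds suffice for every fault set checked below.
  connected? : Bool
  connected? = survives root ∧ all (λ v → not (survives v) ∨ lookup (reachedWithin 6) v) (allVectors 4)

  Survivor : Vertex 2 → Set
  Survivor v = v ∉ S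

  reachedWithin-sound : ∀ n v → T (lookup (reachedWithin n) v) → T (survives root) → Walk 2 Survivor root v
  reachedWithin-sound zero v T-v T-root
    rewrite lookup-tabulate (λ v → does (v ≟ᵛ root)) v with v ≟ᵛ root
  ... | yes refl = here (T-survives T-root)
  reachedWithin-sound (suc n) v T-v T-root
    rewrite lookup-grow (reachedWithin n) v
    with Equivalence.to (T-∨ {lookup (reachedWithin n) v}) T-v
  ... | inj₁ T-old = reachedWithin-sound n v T-old T-root
  ... | inj₂ T-new with Equivalence.to (T-∧ {survives v}) T-new
  ...   | T-v-survives , T-nbr with T-any (lookup (reachedWithin n)) (neighbours₂ v) T-nbr
  ...     | w , w∈ , T-w =
    walk-snoc (reachedWithin-sound n w T-w T-root) (adj-sym (∈-neighbours₂⁻ w∈)) (T-survives T-v-survives)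

  connected?-sound : T connected? → Connected 2 Survivor
  connected?-sound T-connected = connected-via root (λ u u∉ → walk-reverse (from-root u u∉))
    where
    verdict = λ v → not (survives v) ∨ lookup (reachedWithin 6) v
    T-root = proj₁ (Equivalence.to (T-∧ {survives root} {all verdict (allVectors 4)}) T-connected)
    T-every = proj₂ (Equivalence.to (T-∧ {survives root} {all verdict (allVectors 4)}) T-connected)
    from-root : ∀ u → u ∉ S → Walk 2 Survivor root u
    from-root u u∉ with Equivalence.to (T-∨ {not (survives u)}) (T-all verdict (allVectors 4) T-every (∈-allVectors u))
    ... | inj₁ T-dead    = contradiction (subst T (Equivalence.to (T-not-≡ {survives u}) T-dead) (survives-T u∉)) λ ()
    ... | inj₂ T-reached = reachedWithin-sound 6 u T-reached T-root

private
  connected-without : Vertex 2 → Vertex 2 → List (Vertex 2) → Bool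
  connected-without y z A1 = Reachability.connected? (A1 ++ y ∷ z ∷ [])

  connected-without-edges : List (Vertex 2) → Bool
  connected-without-edges A1 = all (λ y → all (λ z → connected-without y z A1) (neighbours₂ y)) (allVectors 4)

opaque
  unfolding Reachability.grow

  vertex-faults-checked : all Reachability.connected? (tuplesUpTo 2 (allVectors 4)) ≡ true
  vertex-faults-checked = refl

  edge-faults-checked : all connected-without-edges (tuplesUpTo 1 (allVectors 4)) ≡ true
  edge-faults-checked = refl

connected?-faults₂ : ∀ (A1 : List (Vertex 2)) A2 → AllAdjacent 2 A2 → length A1 + length A2 ≤ 2 → length A2 ≤ 1 →
                     T (Reachability.connected? (A1 ++ ends 2 A2))
connected?-faults₂ A1 [] _ count≤ _ =
  subst (T ∘ Reachability.connected?) (sym (++-identityʳ A1))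
    (T-all Reachability.connected? (tuplesUpTo 2 (allVectors 4)) (Equivalence.from T-≡ vertex-faults-checked)
           (∈-tuplesUpTo 2 A1 (subst (_≤ 2) (+-identityʳ (length A1)) count≤) (λ {w} _ → ∈-allVectors w)))
connected?-faults₂ A1 ((y , z) ∷ []) (y~z ∷ []) count≤ _ =
  T-all (λ z → connected-without y z A1) (neighbours₂ y)
    (T-all (λ y → all (λ z → connected-without y z A1) (neighbours₂ y)) (allVectors 4)
      (T-all connected-without-edges (tuplesUpTo 1 (allVectors 4)) (Equivalence.from T-≡ edge-faults-checked)
        (∈-tuplesUpTo 1 A1 (+-cancelʳ-≤ 1 (length A1) 1 count≤) (λ {w} _ → ∈-allVectors w)))
      (∈-allVectors y))
    (∈-neighbours₂⁺ y~z)
connected?-faults₂ A1 (_ ∷ _ ∷ _) _ _ (s≤s ())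

faultTolerant₂ : FaultTolerant 2
faultTolerant₂ A1 A2 adjacent count≤ edges≤ u v u-alive v-alive =
  walk-map ∉⇒alive (Reachability.connected?-sound (A1 ++ ends 2 A2) (connected?-faults₂ A1 A2 adjacent count≤ edges≤)
                                                  u v (alive⇒∉ u-alive) (alive⇒∉ v-alive))

faultTolerant : ∀ k → FaultTolerant (suc (suc k))
faultTolerant zero    = faultTolerant₂
faultTolerant (suc k) = faultTolerant-step k (faultTolerant k)

mainTheorem3 : (d : ℕ) → 3 ≤ d →
    (A1 : List (Vertex d)) (A2 : List (Vertex d × Vertex d)) →
    All (λ e → Adj d (proj₁ e) (proj₂ e)) A2 →
    length A1 + length A2 ≤ d →
    length A2 ≤ d ∸ 1 →
    Connected d (Alive d A1 A2)
mainTheorem3 (suc zero)          (s≤s ())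
mainTheorem3 (suc (suc (suc k))) _                  = faultTolerant (suc k)
mainTheorem3 (suc (suc zero))    (s≤s (s≤s ()))
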